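{- Let $\varphi$ be any formula and $\rho,\rho'$ uniform replacements. Then $(\varphi*\rho)*\rho'\approx\varphi*(\rho\rho')$.
   Context: Language: variables $p_1,p_2,\dots$, constants $0,1$, connectives $\neg,\vee$ (others as abbreviations), modal operator $\lozenge$. $\mathbf{E}$ is the smallest set of formulas containing all propositional tautologies and closed under modus ponens, uniform substitution and RE (from $\varphi\leftrightarrow\psi$ infer $\lozenge\varphi\leftrightarrow\lozenge\psi$). $\varphi\approx\psi$ means $\vdash_{\mathbf{E}}\varphi\leftrightarrow\psi$. A uniform replacement (UR) is a formula $\rho(e)$ of modal degree at most 1 in the single variable $e$. For any formula $\varphi$, $\varphi*\rho$ is defined recursively: $0*\rho=0$, $1*\rho=1$, $p_i*\rho=p_i$, $(\psi\vee\theta)*\rho=(\psi*\rho)\vee(\theta*\rho)$, $(\neg\psi)*\rho=\neg(\psi*\rho)$, $(\lozenge\psi)*\rho=\rho(\psi*\rho)$ (substitute $\psi*\rho$ for $e$ in $\rho(e)$). The composition of URs is $\rho\rho':=\rho*\rho'$, i.e. the UR $\rho'$ applied to the formula $\rho(e)$ (with $e$ treated as a variable). -}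

module Defs where

open import Data.Nat using (ℕ; zero; suc; _≤_; _⊔_)
open import Data.Bool using (Bool; true; false; not; _∨_)
open import Data.Unit using (⊤; tt)
open import Relation.Binary.PropositionalEquality using (_≡_)

data Fm (V : Set) : Set where
  var  : V → Fm V
  𝟎 𝟏  : Fm V
  ¬'_  : Fm V → Fm V
  _∨'_ : Fm V → Fm V → Fm V
  ◇_   : Fm V → Fm V

Formula : Set
Formula = Fm ℕ

_→'_ : ∀ {V} → Fm V → Fm V → Fm V
φ →' ψ = (¬' φ) ∨' ψ

_∧'_ : ∀ {V} → Fm V → Fm V → Fm V
φ ∧' ψ = ¬' ((¬' φ) ∨' (¬' ψ))

_↔'_ : ∀ {V} → Fm V → Fm V → Fm V
φ ↔' ψ = (φ →' ψ) ∧' (ψ →' φ)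

md : ∀ {V} → Fm V → ℕ
md (var x) = 0
md 𝟎 = 0
md 𝟏 = 0
md (¬' φ) = md φ
md (φ ∨' ψ) = md φ ⊔ md ψ
md (◇ φ) = suc (md φ)

sub : ∀ {V W} → (V → Fm W) → Fm V → Fm W
sub σ (var x) = σ x
sub σ 𝟎 = 𝟎
sub σ 𝟏 = 𝟏
sub σ (¬' φ) = ¬' sub σ φ
sub σ (φ ∨' ψ) = sub σ φ ∨' sub σ ψ
sub σ (◇ φ) = ◇ sub σ φ

-- Propositional tautologies: true under every Boolean valuation that
-- treats variables and ◇-subformulas as atoms.
module _ {V : Set} where
  evalB : (V → Bool) → (Fm V → Bool) → Fm V → Bool
  evalB v w (var x) = v x
  evalB v w 𝟎 = false
  evalB v w 𝟏 = true
  evalB v w (¬' φ) = not (evalB v w φ)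
  evalB v w (φ ∨' ψ) = evalB v w φ ∨ evalB v w ψ
  evalB v w (◇ φ) = w φ

Tautology : Formula → Set
Tautology φ = (v : ℕ → Bool) (w : Formula → Bool) → evalB v w φ ≡ true

data ⊢E_ : Formula → Set where
  taut : ∀ {φ} → Tautology φ → ⊢E φ
  mp   : ∀ {φ ψ} → ⊢E φ → ⊢E (φ →' ψ) → ⊢E ψ
  usub : ∀ {φ} (σ : ℕ → Formula) → ⊢E φ → ⊢E sub σ φ
  re   : ∀ {φ ψ} → ⊢E (φ ↔' ψ) → ⊢E ((◇ φ) ↔' (◇ ψ))

_≈_ : Formula → Formula → Set
φ ≈ ψ = ⊢E (φ ↔' ψ)

-- Uniform replacements: formulas in the single variable e (the unique
-- element of ⊤) of modal degree at most 1.
URFm : Set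
URFm = Fm ⊤

IsUR : URFm → Set
IsUR ρ = md ρ ≤ 1

_⟨_⟩ : ∀ {V} → URFm → Fm V → Fm V
ρ ⟨ ψ ⟩ = sub (λ _ → ψ) ρ

_*_ : ∀ {V} → Fm V → URFm → Fm V
var x * ρ = var x
𝟎 * ρ = 𝟎
𝟏 * ρ = 𝟏
(¬' φ) * ρ = ¬' (φ * ρ)
(φ ∨' ψ) * ρ = (φ * ρ) ∨' (ψ * ρ)
(◇ φ) * ρ = ρ ⟨ φ * ρ ⟩

_∘UR_ : URFm → URFm → URFm
ρ ∘UR ρ' = ρ * ρ'

-- Replacing ◇ by a uniform replacement commutes with substitution, so
-- (φ * ρ) * ρ' and φ * (ρ * ρ') are the same formula, by induction on φ;
-- the two sides are then E-equivalent because ψ ↔ ψ is a tautology.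
module Submission where

open import Defs
open import Data.Bool using (Bool; true; false; not; _∨_)
open import Function using (_∘_)
open import Relation.Binary.PropositionalEquality
open ≡-Reasoning

sub-cong : ∀ {V W} {σ τ : V → Fm W} → (∀ x → σ x ≡ τ x) →
           (χ : Fm V) → sub σ χ ≡ sub τ χ
sub-cong σ≗τ (var x)  = σ≗τ x
sub-cong σ≗τ 𝟎        = refl
sub-cong σ≗τ 𝟏        = refl
sub-cong σ≗τ (¬' χ)   = cong ¬'_ (sub-cong σ≗τ χ)
sub-cong σ≗τ (χ ∨' ψ) = cong₂ _∨'_ (sub-cong σ≗τ χ) (sub-cong σ≗τ ψ)
sub-cong σ≗τ (◇ χ)    = cong ◇_ (sub-cong σ≗τ χ)

sub-sub : ∀ {U V W} (σ : U → Fm V) (τ : V → Fm W) (χ : Fm U) →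
          sub τ (sub σ χ) ≡ sub (sub τ ∘ σ) χ
sub-sub σ τ (var x)  = refl
sub-sub σ τ 𝟎        = refl
sub-sub σ τ 𝟏        = refl
sub-sub σ τ (¬' χ)   = cong ¬'_ (sub-sub σ τ χ)
sub-sub σ τ (χ ∨' ψ) = cong₂ _∨'_ (sub-sub σ τ χ) (sub-sub σ τ ψ)
sub-sub σ τ (◇ χ)    = cong ◇_ (sub-sub σ τ χ)

*-sub : ∀ {V W} (σ : V → Fm W) (ρ : URFm) (χ : Fm V) →
        sub σ χ * ρ ≡ sub ((_* ρ) ∘ σ) (χ * ρ)
*-sub σ ρ (var x)  = refl
*-sub σ ρ 𝟎        = refl
*-sub σ ρ 𝟏        = refl
*-sub σ ρ (¬' χ)   = cong ¬'_ (*-sub σ ρ χ)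
*-sub σ ρ (χ ∨' ψ) = cong₂ _∨'_ (*-sub σ ρ χ) (*-sub σ ρ ψ)
*-sub σ ρ (◇ χ)    = begin
  ρ ⟨ sub σ χ * ρ ⟩                       ≡⟨ cong (ρ ⟨_⟩) (*-sub σ ρ χ) ⟩
  ρ ⟨ sub ((_* ρ) ∘ σ) (χ * ρ) ⟩          ≡⟨ sub-sub (λ _ → χ * ρ) ((_* ρ) ∘ σ) ρ ⟨
  sub ((_* ρ) ∘ σ) (ρ ⟨ χ * ρ ⟩)          ∎

*-assoc : ∀ {V} (φ : Fm V) (ρ ρ' : URFm) → (φ * ρ) * ρ' ≡ φ * (ρ ∘UR ρ')
*-assoc (var x)  ρ ρ' = refl
*-assoc 𝟎        ρ ρ' = refl
*-assoc 𝟏        ρ ρ' = refl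
*-assoc (¬' φ)   ρ ρ' = cong ¬'_ (*-assoc φ ρ ρ')
*-assoc (φ ∨' ψ) ρ ρ' = cong₂ _∨'_ (*-assoc φ ρ ρ') (*-assoc ψ ρ ρ')
*-assoc (◇ φ)    ρ ρ' = begin
  (ρ ⟨ φ * ρ ⟩) * ρ'                      ≡⟨ *-sub (λ _ → φ * ρ) ρ' ρ ⟩
  (ρ * ρ') ⟨ (φ * ρ) * ρ' ⟩               ≡⟨ sub-cong (λ _ → *-assoc φ ρ ρ') (ρ * ρ') ⟩
  (ρ * ρ') ⟨ φ * (ρ * ρ') ⟩               ∎

≈-refl : (ψ : Formula) → ψ ≈ ψ
≈-refl ψ = taut λ v w → ↔-refl-true (evalB v w ψ)
  where
  ↔-refl-true : (b : Bool) → not (not (not b ∨ b) ∨ not (not b ∨ b)) ≡ true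
  ↔-refl-true true  = refl
  ↔-refl-true false = refl

lemma10 : (φ : Formula) (ρ ρ' : URFm) → IsUR ρ → IsUR ρ' →
          ((φ * ρ) * ρ') ≈ (φ * (ρ ∘UR ρ'))
lemma10 φ ρ ρ' _ _ = subst (((φ * ρ) * ρ') ≈_) (*-assoc φ ρ ρ') (≈-refl _)
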